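{- Fix $t\in\mathbb{N}$. A matroid $M$ is determined, up to isomorphism, by its $t$-expansion $M^t$. Consequently, for matroids $M$ and $N$, $M^t$ and $N^t$ are isomorphic if and only if $M$ and $N$ are isomorphic.
   Context: A cyclic flat of a matroid $M$ is a flat $F$ such that $M|F$ has no coloops; $\mathcal{Z}(M)$ denotes the set of cyclic flats, and a matroid is determined by its cyclic flats and their ranks. The $t$-expansion: for each $e\in E(M)$ let $S_e$ be a $t$-element set with $e\in S_e$, the sets $S_e$ pairwise disjoint; for $X\subseteq E(M)$ let $S_X=\bigcup_{e\in X}S_e$. The $t$-expansion $M^t$ is the matroid on $S_{E(M)}$ whose cyclic flats are exactly the sets $S_A$ with $A\in\mathcal{Z}(M)$, with $r_{M^t}(S_A)=t\cdot r_M(A)$. -}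

module Defs where

open import Data.Nat using (ℕ; _≤_; _<_; _+_; _*_)
open import Data.Fin using (Fin; quotient)
open import Data.Fin.Subset using (Subset; _∈_; _∉_; _⊆_; _∪_; _∩_; _-_; ⁅_⁆; ∣_∣)
open import Data.Vec using (tabulate; lookup)
open import Data.Product using (Σ; ∃; _×_)
open import Function.Bundles using (_↔_; Inverse)
open import Relation.Binary.PropositionalEquality using (_≡_)

record Matroid (n : ℕ) : Set where
  field
    r         : Subset n → ℕ
    r-bounded : ∀ X → r X ≤ ∣ X ∣
    r-mono    : ∀ {X Y} → X ⊆ Y → r X ≤ r Y
    r-submod  : ∀ X Y → r (X ∪ Y) + r (X ∩ Y) ≤ r X + r Y
open Matroid public

IsFlat : ∀ {n} → Matroid n → Subset n → Set
IsFlat M F = ∀ e → e ∉ F → r M F < r M (F ∪ ⁅ e ⁆)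

NoColoopsRestr : ∀ {n} → Matroid n → Subset n → Set
NoColoopsRestr M F = ∀ e → e ∈ F → r M (F - e) ≡ r M F

IsCyclicFlat : ∀ {n} → Matroid n → Subset n → Set
IsCyclicFlat M F = IsFlat M F × NoColoopsRestr M F

-- Ground set of the t-expansion of a matroid on Fin m is Fin (m * t);
-- element k belongs to S_e with e = quotient t k, so each S_e has t elements,
-- the S_e are pairwise disjoint (e is identified with the element of S_e
-- with remainder 0).
S[_]_ : ∀ {m} (t : ℕ) → Subset m → Subset (m * t)
S[_]_ {m} t X = tabulate (λ k → lookup X (quotient {m} t k))

IsExpansion : ∀ {m} (t : ℕ) → Matroid m → Matroid (m * t) → Set
IsExpansion {m} t M Mt =
  (∀ Z → IsCyclicFlat Mt Z → Σ (Subset m) λ A → IsCyclicFlat M A × Z ≡ S[ t ] A)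
  × (∀ A → IsCyclicFlat M A → IsCyclicFlat Mt (S[ t ] A) × r Mt (S[ t ] A) ≡ t * r M A)

preimage : ∀ {m n} → (Fin m → Fin n) → Subset n → Subset m
preimage f X = tabulate (λ i → lookup X (f i))

_≅_ : ∀ {m n} → Matroid m → Matroid n → Set
_≅_ {m} {n} M N = Σ (Fin m ↔ Fin n) λ σ → ∀ X → r N X ≡ r M (preimage (Inverse.to σ) X)

-- A matroid is determined by its cyclic flats and their ranks: r(X) is the least value of
-- r(Z) + |X − Z| over cyclic flats Z.  So M ≅ N as soon as a bijection carries the cyclic
-- flats of M onto those of N without raising ranks, in both directions.
--
-- If M ≅ N, the bijection acting blockwise on the sets S_e is such a bijection between M^t
-- and N^t.  Conversely, let π : M^t ≅ N^t.  Call two elements of M^t inseparable if they lie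
-- in the same cyclic flats; the elements of a block S_e are inseparable, and π preserves
-- inseparability.  Labelling e ∈ E(M) by the class of S_e and f ∈ E(N) by the class of
-- π⁻¹(S_f), each class of size c carries exactly c/t labels on either side, so some bijection
-- τ : E(M) → E(N) preserves labels.  Then π(S_A) = S_{τ(A)} for every cyclic flat A of M,
-- and r_N(τ(A)) = r_M(A) because all ranks are multiplied by t.
{-# OPTIONS --safe #-}
module Submission where

open import Defs
open import Data.Bool using (Bool; true; false; if_then_else_) renaming (_≟_ to _≟ᵇ_)
open import Data.Empty using (⊥-elim)
open import Data.Fin as Fin using (Fin; punchIn; quotient; remainder; combine; _↑ˡ_; _↑ʳ_) renaming (_≟_ to _≟ᶠ_)
open import Data.Fin.Permutation as Permutation using (Permutation; _⟨$⟩ʳ_; insert; insert-punchIn)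
open import Data.Fin.Properties using (splitAt-↑ˡ; splitAt-↑ʳ; *↔×; remQuot-combine; any?; all?)
open import Data.Fin.Subset using (Subset; _∈_; _∉_; _⊆_; _∪_; _─_; _-_; ⁅_⁆; ∣_∣; ∁; ⊥; outside; inside)
open import Data.Fin.Subset.Properties
  using (_∈?_; anySubset?; nonempty?; Empty-unique; ⊆-antisym; x∈⁅x⁆; x∈⁅y⁆⇒x≡y; ∣⁅x⁆∣≡1; ∣⊥∣≡0; ∣p∣≤n; ∣p∣≤∣x∷p∣;
         p⊆q⇒∣p∣≤∣q∣; x∈p∪q⁺; x∉p⇒x∈∁p; x∈∁p⇒x∉p; p─q⊆p; p─q─r≡p─q∪r; ∣p─q∣≤∣p∣; x∈p∧x∉q⇒x∈p─q;
         x∈p∧x≢y⇒x∈p-y; x∈p⇒∣p-x∣<∣p∣)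
open import Data.Nat using (ℕ; zero; suc; _+_; _*_; _≤_; _<_; z≤n; s≤s; s≤s⁻¹; _≤?_; _<?_; _≟_)
open import Data.Nat.Properties
  using (+-*-semiring; +-assoc; +-suc; +-identityʳ; *-zeroʳ; *-distribˡ-+; +-cancelˡ-≡; *-cancelˡ-≡;
         ≤-refl; ≤-reflexive; ≤-trans; ≤-antisym; ≤-<-trans; <-≤-trans; m≤m+n; n≤0⇒n≡0; n≮0; <⇒≢; ≰⇒>; ≮⇒≥;
         +-mono-≤; +-monoˡ-≤; +-monoʳ-≤; module ≤-Reasoning)
open import Data.Product using (Σ; ∃; ∃-syntax; _×_; _,_; proj₁; proj₂)
open import Data.Product.Function.NonDependent.Propositional using (_×-↔_)
open import Data.Sum using (_⊎_; inj₁; inj₂)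
open import Data.Vec using (_∷_; []; here; there; lookup; tabulate; zipWith)
open import Data.Vec.Properties
  using (lookup∘tabulate; tabulate∘lookup; tabulate-cong; lookup-zipWith; []=⇒lookup; lookup⇒[]=; ≡-dec)
open import Data.Vec.Relation.Binary.Pointwise.Extensional using (ext; Pointwise-≡⇒≡)
open import Function using (id; _∘_; _↔_; Inverse; Equivalence; _⇔_; mk⇔)
open import Function.Construct.Composition using (_↔-∘_)
open import Function.Construct.Identity using (↔-id)
open import Function.Construct.Symmetry using (↔-sym)
open import Relation.Binary.Definitions using (DecidableEquality)
open import Relation.Binary.PropositionalEquality
open import Relation.Nullary using (Dec; yes; no; ¬_; ¬?; does)
open import Relation.Nullary.Decidable using (_×-dec_; _⊎-dec_; _→-dec_; decidable-stable; dec-true; does-⇔)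
open import Relation.Unary using (Decidable)
open import Algebra.Properties.Semiring.Sum +-*-semiring using (sum-syntax; sum-cong-≗; sum-remove; ∑-permute)

indicator : Bool → ℕ
indicator b = if b then 1 else 0

∣tabulate∣≡∑ : ∀ {n} (p : Fin n → Bool) → ∣ tabulate p ∣ ≡ ∑[ i < n ] indicator (p i)
∣tabulate∣≡∑ {zero} p = refl
∣tabulate∣≡∑ {suc n} p with p Fin.zero
... | true = cong suc (∣tabulate∣≡∑ (p ∘ Fin.suc))
... | false = ∣tabulate∣≡∑ (p ∘ Fin.suc)

∣tabulate∘permute∣ : ∀ {m n} (π : Permutation m n) (p : Fin n → Bool) →
                     ∣ tabulate (p ∘ (π ⟨$⟩ʳ_)) ∣ ≡ ∣ tabulate p ∣
∣tabulate∘permute∣ π p = begin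
  ∣ tabulate (p ∘ (π ⟨$⟩ʳ_)) ∣           ≡⟨ ∣tabulate∣≡∑ (p ∘ (π ⟨$⟩ʳ_)) ⟩
  ∑[ i < _ ] indicator (p (π ⟨$⟩ʳ i))   ≡⟨ ∑-permute (indicator ∘ p) π ⟨
  ∑[ j < _ ] indicator (p j)            ≡⟨ ∣tabulate∣≡∑ p ⟨
  ∣ tabulate p ∣                        ∎
  where open ≡-Reasoning

∣tabulate∣-punchIn : ∀ {n} (p : Fin (suc n) → Bool) i →
                     ∣ tabulate p ∣ ≡ indicator (p i) + ∣ tabulate (p ∘ punchIn i) ∣
∣tabulate∣-punchIn p i = begin
  ∣ tabulate p ∣
    ≡⟨ ∣tabulate∣≡∑ p ⟩
  ∑[ j < _ ] indicator (p j)
    ≡⟨ sum-remove (indicator ∘ p) ⟩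
  indicator (p i) + ∑[ j < _ ] indicator (p (punchIn i j))
    ≡⟨ cong (indicator (p i) +_) (∣tabulate∣≡∑ (p ∘ punchIn i)) ⟨
  indicator (p i) + ∣ tabulate (p ∘ punchIn i) ∣ ∎
  where open ≡-Reasoning

∑-↑ : ∀ a {b} (f : Fin (a + b) → ℕ) → ∑[ k < a + b ] f k ≡ ∑[ i < a ] f (i ↑ˡ b) + ∑[ j < b ] f (a ↑ʳ j)
∑-↑ zero f = refl
∑-↑ (suc a) f = trans (cong (f Fin.zero +_) (∑-↑ a (f ∘ Fin.suc))) (sym (+-assoc (f Fin.zero) _ _))

∑-const : ∀ s c → ∑[ i < s ] c ≡ s * c
∑-const zero c = refl
∑-const (suc s) c = cong (c +_) (∑-const s c)

quotient-↑ˡ : ∀ {m} s (i : Fin s) → quotient {suc m} s (i ↑ˡ (m * s)) ≡ Fin.zero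
quotient-↑ˡ {m} s i rewrite splitAt-↑ˡ s i (m * s) = refl

quotient-↑ʳ : ∀ {m} s (j : Fin (m * s)) → quotient {suc m} s (s ↑ʳ j) ≡ Fin.suc (quotient {m} s j)
quotient-↑ʳ {m} s j rewrite splitAt-↑ʳ s (m * s) j = refl

∑∘quotient : ∀ {m} s (f : Fin m → ℕ) → ∑[ k < m * s ] f (quotient s k) ≡ s * ∑[ i < m ] f i
∑∘quotient {zero} s f = sym (*-zeroʳ s)
∑∘quotient {suc m} s f = begin
  ∑[ k < suc m * s ] f (quotient s k)
    ≡⟨ ∑-↑ s (f ∘ quotient s) ⟩
  ∑[ i < s ] f (quotient s (i ↑ˡ (m * s))) + ∑[ j < m * s ] f (quotient s (s ↑ʳ j))
    ≡⟨ cong₂ _+_ (sum-cong-≗ (cong f ∘ quotient-↑ˡ s)) (sum-cong-≗ (cong f ∘ quotient-↑ʳ s)) ⟩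
  ∑[ i < s ] f Fin.zero + ∑[ j < m * s ] f (Fin.suc (quotient s j))
    ≡⟨ cong₂ _+_ (∑-const s (f Fin.zero)) (∑∘quotient s (f ∘ Fin.suc)) ⟩
  s * f Fin.zero + s * ∑[ i < m ] f (Fin.suc i)
    ≡⟨ *-distribˡ-+ s _ _ ⟨
  s * ∑[ i < suc m ] f i ∎
  where open ≡-Reasoning

∣tabulate∘quotient∣ : ∀ {m} s (p : Fin m → Bool) → ∣ tabulate (p ∘ quotient s) ∣ ≡ s * ∣ tabulate p ∣
∣tabulate∘quotient∣ {m} s p = begin
  ∣ tabulate (p ∘ quotient s) ∣                ≡⟨ ∣tabulate∣≡∑ (p ∘ quotient s) ⟩
  ∑[ k < m * s ] indicator (p (quotient s k))  ≡⟨ ∑∘quotient s (indicator ∘ p) ⟩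
  s * ∑[ i < m ] indicator (p i)               ≡⟨ cong (s *_) (∣tabulate∣≡∑ p) ⟨
  s * ∣ tabulate p ∣                           ∎
  where open ≡-Reasoning

x∈p─q⇒x∉q : ∀ {n} {x : Fin n} (p q : Subset n) → x ∈ p ─ q → x ∉ q
x∈p─q⇒x∉q (inside ∷ p) (outside ∷ q) here ()
x∈p─q⇒x∉q (s ∷ p) (outside ∷ q) (there x∈d) (there x∈q) = x∈p─q⇒x∉q p q x∈d x∈q
x∈p─q⇒x∉q (s ∷ p) (inside ∷ q) (there x∈d) (there x∈q) = x∈p─q⇒x∉q p q x∈d x∈q

∣p∪q∣≤∣p∣+∣q∣ : ∀ {n} (p q : Subset n) → ∣ p ∪ q ∣ ≤ ∣ p ∣ + ∣ q ∣
∣p∪q∣≤∣p∣+∣q∣ [] [] = z≤n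
∣p∪q∣≤∣p∣+∣q∣ (outside ∷ p) (outside ∷ q) = ∣p∪q∣≤∣p∣+∣q∣ p q
∣p∪q∣≤∣p∣+∣q∣ (outside ∷ p) (inside ∷ q) =
  subst (suc ∣ p ∪ q ∣ ≤_) (sym (+-suc ∣ p ∣ ∣ q ∣)) (s≤s (∣p∪q∣≤∣p∣+∣q∣ p q))
∣p∪q∣≤∣p∣+∣q∣ (inside ∷ p) (t ∷ q) =
  s≤s (≤-trans (∣p∪q∣≤∣p∣+∣q∣ p q) (+-monoʳ-≤ ∣ p ∣ (∣p∣≤∣x∷p∣ t q)))

∣p─p∣≡0 : ∀ {n} (p : Subset n) → ∣ p ─ p ∣ ≡ 0
∣p─p∣≡0 {n} p = n≤0⇒n≡0 (subst (∣ p ─ p ∣ ≤_) (∣⊥∣≡0 n) (p⊆q⇒∣p∣≤∣q∣ p─p⊆⊥))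
  where
  p─p⊆⊥ : p ─ p ⊆ ⊥
  p─p⊆⊥ x∈ = ⊥-elim (x∈p─q⇒x∉q p p x∈ (p─q⊆p p p x∈))

∣p─[q∪⁅x⁆]∣≤∣p─q∣ : ∀ {n} (p q : Subset n) x → ∣ p ─ (q ∪ ⁅ x ⁆) ∣ ≤ ∣ p ─ q ∣
∣p─[q∪⁅x⁆]∣≤∣p─q∣ p q x = subst (_≤ ∣ p ─ q ∣) (cong ∣_∣ (p─q─r≡p─q∪r p q ⁅ x ⁆)) (∣p─q∣≤∣p∣ (p ─ q) ⁅ x ⁆)

∣p─[q-x]∣≤1+∣p─q∣ : ∀ {n} (p q : Subset n) x → ∣ p ─ (q - x) ∣ ≤ suc ∣ p ─ q ∣
∣p─[q-x]∣≤1+∣p─q∣ p q x = begin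
  ∣ p ─ (q - x) ∣          ≤⟨ p⊆q⇒∣p∣≤∣q∣ ⊆⁅x⁆∪p─q ⟩
  ∣ ⁅ x ⁆ ∪ (p ─ q) ∣      ≤⟨ ∣p∪q∣≤∣p∣+∣q∣ ⁅ x ⁆ (p ─ q) ⟩
  ∣ ⁅ x ⁆ ∣ + ∣ p ─ q ∣    ≡⟨ cong (_+ ∣ p ─ q ∣) (∣⁅x⁆∣≡1 x) ⟩
  suc ∣ p ─ q ∣            ∎
  where
  open ≤-Reasoning
  ⊆⁅x⁆∪p─q : p ─ (q - x) ⊆ ⁅ x ⁆ ∪ (p ─ q)
  ⊆⁅x⁆∪p─q {y} y∈ with y ≟ᶠ x
  ... | yes refl = x∈p∪q⁺ (inj₁ (x∈⁅x⁆ x))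
  ... | no y≢x = x∈p∪q⁺ (inj₂ (x∈p∧x∉q⇒x∈p─q (p─q⊆p p (q - x) y∈)
                   (λ y∈q → x∈p─q⇒x∉q p (q - x) y∈ (x∈p∧x≢y⇒x∈p-y y∈q y≢x))))

∣∁[p∪⁅x⁆]∣<∣∁p∣ : ∀ {n} (p : Subset n) {x} → x ∉ p → ∣ ∁ (p ∪ ⁅ x ⁆) ∣ < ∣ ∁ p ∣
∣∁[p∪⁅x⁆]∣<∣∁p∣ p {x} x∉p = ≤-<-trans (p⊆q⇒∣p∣≤∣q∣ ⊆∁p-x) (x∈p⇒∣p-x∣<∣p∣ (x∉p⇒x∈∁p x∉p))
  where
  ⊆∁p-x : ∁ (p ∪ ⁅ x ⁆) ⊆ ∁ p - x
  ⊆∁p-x y∈ = x∈p∧x≢y⇒x∈p-y (x∉p⇒x∈∁p (λ y∈p → y∉ (x∈p∪q⁺ (inj₁ y∈p))))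
                            (λ y≡x → y∉ (x∈p∪q⁺ (inj₂ (subst (_∈ ⁅ x ⁆) (sym y≡x) (x∈⁅x⁆ x)))))
    where y∉ = x∈∁p⇒x∉p y∈

-- Rank functions and cyclic flats

module _ {n} (M : Matroid n) where

  r-subadditive : ∀ X Y → r M (X ∪ Y) ≤ r M X + r M Y
  r-subadditive X Y = ≤-trans (m≤m+n _ _) (r-submod M X Y)

  r≤r+∣─∣ : ∀ X Z → r M X ≤ r M Z + ∣ X ─ Z ∣
  r≤r+∣─∣ X Z = begin
    r M X                 ≤⟨ r-mono M X⊆Z∪X─Z ⟩
    r M (Z ∪ (X ─ Z))     ≤⟨ r-subadditive Z (X ─ Z) ⟩
    r M Z + r M (X ─ Z)   ≤⟨ +-monoʳ-≤ (r M Z) (r-bounded M (X ─ Z)) ⟩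
    r M Z + ∣ X ─ Z ∣     ∎
    where
    open ≤-Reasoning
    X⊆Z∪X─Z : X ⊆ Z ∪ (X ─ Z)
    X⊆Z∪X─Z {x} x∈X with x ∈? Z
    ... | yes x∈Z = x∈p∪q⁺ (inj₁ x∈Z)
    ... | no x∉Z = x∈p∪q⁺ (inj₂ (x∈p∧x∉q⇒x∈p─q x∈X x∉Z))

  isCyclicFlat? : Decidable (IsCyclicFlat M)
  isCyclicFlat? Z =
    all? (λ e → ¬? (e ∈? Z) →-dec (r M Z <? r M (Z ∪ ⁅ e ⁆)))
    ×-dec all? (λ e → (e ∈? Z) →-dec (r M (Z - e) ≟ r M Z))

  Defect : Subset n → Fin n → Set
  Defect Z e = (e ∉ Z × r M (Z ∪ ⁅ e ⁆) ≤ r M Z) ⊎ (e ∈ Z × r M (Z - e) < r M Z)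

  defect? : ∀ Z → Decidable (Defect Z)
  defect? Z e = (¬? (e ∈? Z) ×-dec (r M (Z ∪ ⁅ e ⁆) ≤? r M Z))
                ⊎-dec ((e ∈? Z) ×-dec (r M (Z - e) <? r M Z))

  noDefect⇒cyclicFlat : ∀ Z → ¬ ∃ (Defect Z) → IsCyclicFlat M Z
  noDefect⇒cyclicFlat Z noDefect =
    (λ e e∉Z → ≰⇒> (λ r≤ → noDefect (e , inj₁ (e∉Z , r≤)))) ,
    (λ e e∈Z → ≤-antisym (r-mono M (p─q⊆p Z ⁅ e ⁆)) (≮⇒≥ (λ r< → noDefect (e , inj₂ (e∈Z , r<)))))

  excess-grow : ∀ X Z e → r M (Z ∪ ⁅ e ⁆) ≤ r M Z →
                r M (Z ∪ ⁅ e ⁆) + ∣ X ─ (Z ∪ ⁅ e ⁆) ∣ ≤ r M Z + ∣ X ─ Z ∣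
  excess-grow X Z e r≤ = +-mono-≤ r≤ (∣p─[q∪⁅x⁆]∣≤∣p─q∣ X Z e)

  excess-shrink : ∀ X Z e → r M (Z - e) < r M Z →
                  r M (Z - e) + ∣ X ─ (Z - e) ∣ ≤ r M Z + ∣ X ─ Z ∣
  excess-shrink X Z e r< = begin
    r M (Z - e) + ∣ X ─ (Z - e) ∣    ≤⟨ +-monoʳ-≤ (r M (Z - e)) (∣p─[q-x]∣≤1+∣p─q∣ X Z e) ⟩
    r M (Z - e) + suc ∣ X ─ Z ∣      ≡⟨ +-suc (r M (Z - e)) ∣ X ─ Z ∣ ⟩
    suc (r M (Z - e)) + ∣ X ─ Z ∣    ≤⟨ +-monoˡ-≤ ∣ X ─ Z ∣ r< ⟩
    r M Z + ∣ X ─ Z ∣                ∎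
    where open ≤-Reasoning

  -- Add a rank-neutral element or delete a coloop until none is left: neither step raises
  -- r Z + |X − Z|, and (r Z, |∁ Z|), bounded by (a, b), decreases lexicographically.
  descend : ∀ X a b Z → r M Z ≤ a → ∣ ∁ Z ∣ ≤ b →
            ∃[ Y ] IsCyclicFlat M Y × r M Y + ∣ X ─ Y ∣ ≤ r M Z + ∣ X ─ Z ∣
  descend X a b Z rZ≤a ∣∁Z∣≤b with any? (defect? Z)
  ... | no noDefect = Z , noDefect⇒cyclicFlat Z noDefect , ≤-refl
  descend X a zero Z rZ≤a ∣∁Z∣≤0 | yes (e , inj₁ (e∉Z , _)) =
    ⊥-elim (n≮0 (<-≤-trans (∣∁[p∪⁅x⁆]∣<∣∁p∣ Z e∉Z) ∣∁Z∣≤0))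
  descend X a (suc b) Z rZ≤a ∣∁Z∣≤b | yes (e , inj₁ (e∉Z , r≤)) =
    let Y , cf , ≤excess = descend X a b (Z ∪ ⁅ e ⁆) (≤-trans r≤ rZ≤a)
                             (s≤s⁻¹ (<-≤-trans (∣∁[p∪⁅x⁆]∣<∣∁p∣ Z e∉Z) ∣∁Z∣≤b))
    in Y , cf , ≤-trans ≤excess (excess-grow X Z e r≤)
  descend X zero b Z rZ≤0 _ | yes (e , inj₂ (_ , r<)) = ⊥-elim (n≮0 (<-≤-trans r< rZ≤0))
  descend X (suc a) b Z rZ≤a _ | yes (e , inj₂ (_ , r<)) =
    let Y , cf , ≤excess = descend X a n (Z - e) (s≤s⁻¹ (<-≤-trans r< rZ≤a)) (∣p∣≤n (∁ (Z - e)))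
    in Y , cf , ≤-trans ≤excess (excess-shrink X Z e r<)

  ∃cyclicFlat[r+∣─∣≤r] : ∀ X → ∃[ Z ] IsCyclicFlat M Z × r M Z + ∣ X ─ Z ∣ ≤ r M X
  ∃cyclicFlat[r+∣─∣≤r] X =
    let Z , cf , ≤excess = descend X (r M X) n X ≤-refl (∣p∣≤n (∁ X))
    in Z , cf , subst (r M Z + ∣ X ─ Z ∣ ≤_) (trans (cong (r M X +_) (∣p─p∣≡0 X)) (+-identityʳ (r M X))) ≤excess

lookup-preimage : ∀ {m n} (f : Fin m → Fin n) X i → lookup (preimage f X) i ≡ lookup X (f i)
lookup-preimage f X = lookup∘tabulate (lookup X ∘ f)

∈-preimage : ∀ {m n} {f : Fin m → Fin n} {X i} → i ∈ preimage f X ⇔ f i ∈ X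
∈-preimage {f = f} {X} {i} = mk⇔
  (λ i∈ → lookup⇒[]= (f i) X (trans (sym (lookup-preimage f X i)) ([]=⇒lookup i∈)))
  (λ fi∈ → lookup⇒[]= i (preimage f X) (trans (lookup-preimage f X i) ([]=⇒lookup fi∈)))

preimage-zipWith : ∀ {m n} (g : Bool → Bool → Bool) (f : Fin m → Fin n) X Y →
                   preimage f (zipWith g X Y) ≡ zipWith g (preimage f X) (preimage f Y)
preimage-zipWith g f X Y = Pointwise-≡⇒≡ (ext λ i → begin
  lookup (preimage f (zipWith g X Y)) i           ≡⟨ lookup-preimage f (zipWith g X Y) i ⟩
  lookup (zipWith g X Y) (f i)                    ≡⟨ lookup-zipWith g (f i) X Y ⟩
  g (lookup X (f i)) (lookup Y (f i))             ≡⟨ cong₂ g (lookup-preimage f X i) (lookup-preimage f Y i) ⟨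
  g (lookup (preimage f X) i) (lookup (preimage f Y) i) ≡⟨ lookup-zipWith g i (preimage f X) (preimage f Y) ⟨
  lookup (zipWith g (preimage f X) (preimage f Y)) i ∎)
  where open ≡-Reasoning

module _ {m n} (σ : Fin m ↔ Fin n) where
  open Inverse σ

  image : Subset m → Subset n
  image = preimage from

  ∣image∣ : ∀ X → ∣ image X ∣ ≡ ∣ X ∣
  ∣image∣ X = trans (∣tabulate∘permute∣ (↔-sym σ) (lookup X)) (cong ∣_∣ (tabulate∘lookup X))

  preimage∘image : ∀ X → preimage to (image X) ≡ X
  preimage∘image X = Pointwise-≡⇒≡ (ext λ i →
    trans (lookup-preimage to (image X) i)
          (trans (lookup-preimage from X (to i)) (cong (lookup X) (strictlyInverseʳ i))))

  image-⁅⁆ : ∀ x → image ⁅ x ⁆ ≡ ⁅ to x ⁆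
  image-⁅⁆ x = ⊆-antisym ⊆⁅to-x⁆ ⁅to-x⁆⊆
    where
    ⊆⁅to-x⁆ : image ⁅ x ⁆ ⊆ ⁅ to x ⁆
    ⊆⁅to-x⁆ j∈ = subst (_∈ ⁅ to x ⁆) (inverseˡ (sym from-j≡x)) (x∈⁅x⁆ (to x))
      where from-j≡x = x∈⁅y⁆⇒x≡y x (Equivalence.to ∈-preimage j∈)
    ⁅to-x⁆⊆ : ⁅ to x ⁆ ⊆ image ⁅ x ⁆
    ⁅to-x⁆⊆ j∈ = Equivalence.from ∈-preimage (subst (_∈ ⁅ x ⁆) (sym from-j≡x) (x∈⁅x⁆ x))
      where from-j≡x = inverseʳ (x∈⁅y⁆⇒x≡y (to x) j∈)

module _ {m n} (M : Matroid m) (N : Matroid n) (iso : M ≅ N) where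
  private
    σ = proj₁ iso
  open Inverse σ

  r-image : ∀ X → r N (image σ X) ≡ r M X
  r-image X = trans (proj₂ iso (image σ X)) (cong (r M) (preimage∘image σ X))

  r-image-zipWith-⁅⁆ : ∀ (g : Bool → Bool → Bool) Z e →
                       r N (zipWith g (image σ Z) ⁅ e ⁆) ≡ r M (zipWith g Z ⁅ from e ⁆)
  r-image-zipWith-⁅⁆ g Z e = begin
    r N (zipWith g (image σ Z) ⁅ e ⁆)                  ≡⟨ cong (λ y → r N (zipWith g (image σ Z) ⁅ y ⁆)) (strictlyInverseˡ e) ⟨
    r N (zipWith g (image σ Z) ⁅ to (from e) ⁆)        ≡⟨ cong (λ W → r N (zipWith g (image σ Z) W)) (image-⁅⁆ σ (from e)) ⟨
    r N (zipWith g (image σ Z) (image σ ⁅ from e ⁆))   ≡⟨ cong (r N) (preimage-zipWith g from Z ⁅ from e ⁆) ⟨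
    r N (image σ (zipWith g Z ⁅ from e ⁆))             ≡⟨ r-image (zipWith g Z ⁅ from e ⁆) ⟩
    r M (zipWith g Z ⁅ from e ⁆)                       ∎
    where open ≡-Reasoning

  image-cyclicFlat : ∀ Z → IsCyclicFlat M Z → IsCyclicFlat N (image σ Z)
  image-cyclicFlat Z (flat , noColoops) =
    (λ e e∉ → subst₂ _<_ (sym (r-image Z)) (sym (r-image-zipWith-⁅⁆ _ Z e))
                (flat (from e) (λ fe∈ → e∉ (Equivalence.from ∈-preimage fe∈)))) ,
    (λ e e∈ → trans (r-image-zipWith-⁅⁆ _ Z e)
                (trans (noColoops (from e) (Equivalence.to ∈-preimage e∈)) (sym (r-image Z))))

≅-sym : ∀ {m n} (M : Matroid m) (N : Matroid n) → M ≅ N → N ≅ M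
≅-sym M N iso = ↔-sym (proj₁ iso) , λ X → sym (r-image M N iso X)

module _ {m n} (M : Matroid m) (N : Matroid n) (σ : Fin m ↔ Fin n) where
  open Inverse σ

  r≤r∘preimage-from-cyclicFlats : (∀ Z → IsCyclicFlat M Z → r N (image σ Z) ≤ r M Z) →
                                  ∀ X → r N X ≤ r M (preimage to X)
  r≤r∘preimage-from-cyclicFlats r≤ X with ∃cyclicFlat[r+∣─∣≤r] M (preimage to X)
  ... | Z , cf , ≤excess = begin
    r N X                                    ≤⟨ r≤r+∣─∣ N X (image σ Z) ⟩
    r N (image σ Z) + ∣ X ─ image σ Z ∣      ≤⟨ +-monoˡ-≤ _ (r≤ Z cf) ⟩
    r M Z + ∣ X ─ image σ Z ∣                ≡⟨ cong (r M Z +_) ∣X─σZ∣≡∣σ⁻¹X─Z∣ ⟩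
    r M Z + ∣ preimage to X ─ Z ∣            ≤⟨ ≤excess ⟩
    r M (preimage to X)                      ∎
    where
    open ≤-Reasoning
    ∣X─σZ∣≡∣σ⁻¹X─Z∣ : ∣ X ─ image σ Z ∣ ≡ ∣ preimage to X ─ Z ∣
    ∣X─σZ∣≡∣σ⁻¹X─Z∣ = begin-equality
      ∣ X ─ image σ Z ∣                              ≡⟨ ∣image∣ (↔-sym σ) (X ─ image σ Z) ⟨
      ∣ preimage to (X ─ image σ Z) ∣                ≡⟨ cong ∣_∣ (preimage-zipWith _ to X (image σ Z)) ⟩
      ∣ preimage to X ─ preimage to (image σ Z) ∣    ≡⟨ cong (λ W → ∣ preimage to X ─ W ∣) (preimage∘image σ Z) ⟩
      ∣ preimage to X ─ Z ∣                          ∎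

≅-from-cyclicFlats : ∀ {m n} (M : Matroid m) (N : Matroid n) (σ : Fin m ↔ Fin n) →
                     (∀ Z → IsCyclicFlat M Z → r N (image σ Z) ≤ r M Z) →
                     (∀ Z → IsCyclicFlat N Z → r M (image (↔-sym σ) Z) ≤ r N Z) → M ≅ N
≅-from-cyclicFlats M N σ r≤ᴹ r≤ᴺ = σ , λ X → ≤-antisym
  (r≤r∘preimage-from-cyclicFlats M N σ r≤ᴹ X)
  (subst (r M (preimage (Inverse.to σ) X) ≤_) (cong (r N) (preimage∘image (↔-sym σ) X))
    (r≤r∘preimage-from-cyclicFlats N M (↔-sym σ) r≤ᴺ (preimage (Inverse.to σ) X)))

-- Matching two labellings with equal multiplicities

does≡true⇒ : ∀ {A : Set} (a? : Dec A) → does a? ≡ true → A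
does≡true⇒ (yes a) _ = a

module _ {K : Set} (_≟_ : DecidableEquality K) where

  fibre : ∀ {m} → (Fin m → K) → K → Subset m
  fibre f k = tabulate (λ x → does (f x ≟ k))

  ∣fibre∣-punchIn : ∀ {m} (f : Fin (suc m) → K) k x →
                    ∣ fibre f k ∣ ≡ indicator (does (f x ≟ k)) + ∣ fibre (f ∘ punchIn x) k ∣
  ∣fibre∣-punchIn f k = ∣tabulate∣-punchIn (λ x → does (f x ≟ k))

  0<∣fibre∣ : ∀ {m} (f : Fin m → K) x → 0 < ∣ fibre f (f x) ∣
  0<∣fibre∣ {suc m} f x rewrite ∣fibre∣-punchIn f (f x) x | dec-true (f x ≟ f x) refl = s≤s z≤n

  0<∣fibre∣⇒∃ : ∀ {m} (f : Fin m → K) k → 0 < ∣ fibre f k ∣ → ∃ λ x → f x ≡ k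
  0<∣fibre∣⇒∃ {m} f k 0<∣f⁻¹k∣ with nonempty? (fibre f k)
  ... | yes (x , x∈) = x , does≡true⇒ (f x ≟ k) (trans (sym (lookup∘tabulate _ x)) ([]=⇒lookup x∈))
  ... | no empty = ⊥-elim (<⇒≢ 0<∣f⁻¹k∣ (sym (trans (cong ∣_∣ (Empty-unique empty)) (∣⊥∣≡0 m))))

  match : ∀ {m n} (f : Fin m → K) (g : Fin n → K) →
          (∀ x → ∣ fibre f (f x) ∣ ≡ ∣ fibre g (f x) ∣) →
          (∀ y → ∣ fibre f (g y) ∣ ≡ ∣ fibre g (g y) ∣) →
          Σ (Fin m ↔ Fin n) λ σ → ∀ x → g (Inverse.to σ x) ≡ f x
  match {zero} {zero} f g _ _ = Permutation.id , λ ()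
  match {zero} {suc n} f g _ same-g = ⊥-elim (<⇒≢ (0<∣fibre∣ g Fin.zero) (same-g Fin.zero))
  match {suc m} {zero} f g same-f _ = ⊥-elim (n≮0 (subst (0 <_) (same-f Fin.zero) (0<∣fibre∣ f Fin.zero)))
  match {suc m} {suc n} f g same-f same-g
    with 0<∣fibre∣⇒∃ g (f Fin.zero) (subst (0 <_) (same-f Fin.zero) (0<∣fibre∣ f Fin.zero))
  ... | y , gy≡f0 = insert Fin.zero y σ′ , matches
    where
    f′ = f ∘ Fin.suc
    g′ = g ∘ punchIn y
    same′ : ∀ k → ∣ fibre f k ∣ ≡ ∣ fibre g k ∣ → ∣ fibre f′ k ∣ ≡ ∣ fibre g′ k ∣
    same′ k eq = +-cancelˡ-≡ (indicator (does (f Fin.zero ≟ k))) _ _ (begin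
      indicator (does (f Fin.zero ≟ k)) + ∣ fibre f′ k ∣   ≡⟨ ∣fibre∣-punchIn f k Fin.zero ⟨
      ∣ fibre f k ∣                                       ≡⟨ eq ⟩
      ∣ fibre g k ∣                                       ≡⟨ ∣fibre∣-punchIn g k y ⟩
      indicator (does (g y ≟ k)) + ∣ fibre g′ k ∣         ≡⟨ cong (λ z → indicator (does (z ≟ k)) + ∣ fibre g′ k ∣) gy≡f0 ⟩
      indicator (does (f Fin.zero ≟ k)) + ∣ fibre g′ k ∣  ∎)
      where open ≡-Reasoning
    rest = match f′ g′ (λ x → same′ (f′ x) (same-f (Fin.suc x))) (λ z → same′ (g′ z) (same-g (punchIn y z)))
    σ′ = proj₁ rest
    matches : ∀ x → g (insert Fin.zero y σ′ ⟨$⟩ʳ x) ≡ f x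
    matches Fin.zero = gy≡f0
    matches (Fin.suc x) = trans (cong g (insert-punchIn Fin.zero y σ′ x)) (proj₂ rest x)

-- Elements lying in the same cyclic flats

module _ {K} (T : Matroid K) where

  Inseparable : Fin K → Fin K → Set
  Inseparable k l = ∀ Z → IsCyclicFlat T Z → lookup Z k ≡ lookup Z l

  inseparable? : ∀ k l → Dec (Inseparable k l)
  inseparable? k l with anySubset? (λ Z → isCyclicFlat? T Z ×-dec ¬? (lookup Z k ≟ᵇ lookup Z l))
  ... | yes (Z , cf , k≢l) = no λ insep → k≢l (insep Z cf)
  ... | no noSeparator = yes λ Z cf → decidable-stable (lookup Z k ≟ᵇ lookup Z l) λ k≢l → noSeparator (Z , cf , k≢l)

  inseparable-refl : ∀ {k} → Inseparable k k
  inseparable-refl Z cf = refl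

  inseparable-sym : ∀ {k l} → Inseparable k l → Inseparable l k
  inseparable-sym k∼l Z cf = sym (k∼l Z cf)

  inseparable-trans : ∀ {k l j} → Inseparable k l → Inseparable l j → Inseparable k j
  inseparable-trans k∼l l∼j Z cf = trans (k∼l Z cf) (l∼j Z cf)

  class : Fin K → Subset K
  class k = tabulate (λ l → does (inseparable? k l))

  lookup-class : ∀ k l → lookup (class k) l ≡ does (inseparable? k l)
  lookup-class k = lookup∘tabulate (λ l → does (inseparable? k l))

  class≡⇒inseparable : ∀ {k l} → class k ≡ class l → Inseparable k l
  class≡⇒inseparable {k} {l} classk≡classl = does≡true⇒ (inseparable? k l) (begin
    does (inseparable? k l)   ≡⟨ lookup-class k l ⟨
    lookup (class k) l        ≡⟨ cong (λ C → lookup C l) classk≡classl ⟩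
    lookup (class l) l        ≡⟨ lookup-class l l ⟩
    does (inseparable? l l)   ≡⟨ dec-true (inseparable? l l) inseparable-refl ⟩
    true                      ∎)
    where open ≡-Reasoning

  inseparable⇒class≡ : ∀ {k l} → Inseparable k l → class k ≡ class l
  inseparable⇒class≡ {k} {l} k∼l = Pointwise-≡⇒≡ (ext λ j → trans (lookup-class k j) (trans
    (does-⇔ (mk⇔ (inseparable-trans (inseparable-sym k∼l)) (inseparable-trans k∼l)) (inseparable? k j) (inseparable? l j))
    (sym (lookup-class l j))))

≅-preserves-inseparable : ∀ {m n} (M : Matroid m) (N : Matroid n) (iso : M ≅ N) {k l} →
                          Inseparable M k l → Inseparable N (Inverse.to (proj₁ iso) k) (Inverse.to (proj₁ iso) l)
≅-preserves-inseparable M N iso {k} {l} k∼l W cf = begin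
  lookup W (to k)                ≡⟨ lookup-preimage to W k ⟨
  lookup (preimage to W) k       ≡⟨ k∼l (preimage to W) (image-cyclicFlat N M (≅-sym M N iso) W cf) ⟩
  lookup (preimage to W) l       ≡⟨ lookup-preimage to W l ⟩
  lookup W (to l)                ∎
  where
  open ≡-Reasoning
  open Inverse (proj₁ iso)

-- Expansions

module _ (s : ℕ) where

  quotient-combine : ∀ {m} (e : Fin m) (z : Fin s) → quotient s (combine e z) ≡ e
  quotient-combine e z = cong proj₁ (remQuot-combine e z)

  lookup-S : ∀ {m} (A : Subset m) k → lookup (S[ s ] A) k ≡ lookup A (quotient s k)
  lookup-S {m} A = lookup∘tabulate (λ k → lookup A (quotient {m} s k))

  lookup-S-combine : ∀ {m} (A : Subset m) e z → lookup (S[ s ] A) (combine e z) ≡ lookup A e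
  lookup-S-combine A e z = trans (lookup-S A (combine e z)) (cong (lookup A) (quotient-combine e z))

  blockIso : ∀ {m n} → Fin m ↔ Fin n → Fin (m * s) ↔ Fin (n * s)
  blockIso σ = ↔-sym *↔× ↔-∘ ((σ ×-↔ ↔-id (Fin s)) ↔-∘ *↔×)

  image-blockIso-S : ∀ {m n} (σ : Fin m ↔ Fin n) A → image (blockIso σ) (S[ s ] A) ≡ S[ s ] (image σ A)
  image-blockIso-S {m} {n} σ A = Pointwise-≡⇒≡ (ext λ k → begin
    lookup (image (blockIso σ) (S[ s ] A)) k                               ≡⟨ lookup-preimage _ (S[ s ] A) k ⟩
    lookup (S[ s ] A) (combine (from (quotient s k)) (remainder {n} s k))  ≡⟨ lookup-S-combine A _ _ ⟩
    lookup A (from (quotient s k))                                          ≡⟨ lookup-preimage from A (quotient s k) ⟨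
    lookup (image σ A) (quotient s k)                                       ≡⟨ lookup-S (image σ A) k ⟨
    lookup (S[ s ] (image σ A)) k                                           ∎)
    where
    open ≡-Reasoning
    open Inverse σ

  expansion-inseparable-block : ∀ {m} (M : Matroid m) (Mt : Matroid (m * s)) → IsExpansion s M Mt →
                                ∀ k z → Inseparable Mt k (combine (quotient {m} s k) z)
  expansion-inseparable-block {m} M Mt eM k z Z cf with proj₁ eM Z cf
  ... | A , _ , refl = trans (lookup-S A k) (sym (lookup-S-combine A (quotient {m} s k) z))

  r-image-blockIso : ∀ {m n} (M : Matroid m) (N : Matroid n) (Mt : Matroid (m * s)) (Nt : Matroid (n * s)) →
                     IsExpansion s M Mt → IsExpansion s N Nt → (iso : M ≅ N) →
                     ∀ Z → IsCyclicFlat Mt Z → r Nt (image (blockIso (proj₁ iso)) Z) ≤ r Mt Z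
  r-image-blockIso M N Mt Nt eM eN iso Z cf with proj₁ eM Z cf
  ... | A , cfA , refl = ≤-reflexive (begin
    r Nt (image (blockIso σ) (S[ s ] A))  ≡⟨ cong (r Nt) (image-blockIso-S σ A) ⟩
    r Nt (S[ s ] (image σ A))             ≡⟨ proj₂ (proj₂ eN (image σ A) (image-cyclicFlat M N iso A cfA)) ⟩
    s * r N (image σ A)                   ≡⟨ cong (s *_) (r-image M N iso A) ⟩
    s * r M A                             ≡⟨ proj₂ (proj₂ eM A cfA) ⟨
    r Mt (S[ s ] A)                       ∎)
    where
    open ≡-Reasoning
    σ = proj₁ iso

  expansion-≅ : ∀ {m n} (M : Matroid m) (N : Matroid n) (Mt : Matroid (m * s)) (Nt : Matroid (n * s)) →
                IsExpansion s M Mt → IsExpansion s N Nt → M ≅ N → Mt ≅ Nt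
  expansion-≅ M N Mt Nt eM eN iso = ≅-from-cyclicFlats Mt Nt (blockIso (proj₁ iso))
    (r-image-blockIso M N Mt Nt eM eN iso) (r-image-blockIso N M Nt Mt eN eM (≅-sym M N iso))

_≟ˢ_ : ∀ {n} → DecidableEquality (Subset n)
_≟ˢ_ = ≡-dec _≟ᵇ_

module _ (t : ℕ) where

  base : ∀ {k} → Fin k → Fin (k * suc t)
  base e = combine e Fin.zero

  module _ {K n} (T : Matroid K) (g : Fin (n * suc t) → Fin K)
           (g-blocks : ∀ j → Inseparable T (g j) (g (base (quotient {n} (suc t) j)))) where

    signature : Fin n → Subset K
    signature = class T ∘ g ∘ base

    lookup-class∘g : ∀ k₀ j → lookup (class T k₀) (g j) ≡ does (signature (quotient (suc t) j) ≟ˢ class T k₀)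
    lookup-class∘g k₀ j = trans (lookup-class T k₀ (g j)) (does-⇔ (mk⇔
      (λ k₀∼gj → sym (inseparable⇒class≡ T (inseparable-trans T k₀∼gj (g-blocks j))))
      (λ sig≡ → inseparable-trans T (inseparable-sym T (class≡⇒inseparable T sig≡)) (inseparable-sym T (g-blocks j))))
      (inseparable? T k₀ (g j)) (signature (quotient (suc t) j) ≟ˢ class T k₀))

    ∣preimage-class∣ : ∀ k₀ → ∣ preimage g (class T k₀) ∣ ≡ suc t * ∣ fibre _≟ˢ_ signature (class T k₀) ∣
    ∣preimage-class∣ k₀ = trans (cong ∣_∣ (tabulate-cong (lookup-class∘g k₀)))
                                (∣tabulate∘quotient∣ (suc t) (λ e → does (signature e ≟ˢ class T k₀)))

  module _ {m n} (M : Matroid m) (N : Matroid n) (Mt : Matroid (m * suc t)) (Nt : Matroid (n * suc t))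
           (eM : IsExpansion (suc t) M Mt) (eN : IsExpansion (suc t) N Nt) (iso : Mt ≅ Nt) where
    private
      module π = Inverse (proj₁ iso)

    Compatible : Fin m ↔ Fin n → Set
    Compatible τ = ∀ f → Inseparable Mt (π.from (base f)) (base (Inverse.from τ f))

    r-image-≤ : ∀ τ → Compatible τ → ∀ A → IsCyclicFlat M A → r N (image τ A) ≤ r M A
    r-image-≤ τ compatible A cfA with proj₂ eM A cfA
    ... | cfSA , rSA≡ with proj₁ eN (image (proj₁ iso) (S[ suc t ] A)) (image-cyclicFlat Mt Nt iso _ cfSA)
    ... | B , cfB , πSA≡SB = ≤-reflexive (trans (cong (r N) (sym B≡τA)) rB≡rA)
      where
      open ≡-Reasoning
      module τ = Inverse τ
      rB≡rA : r N B ≡ r M A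
      rB≡rA = *-cancelˡ-≡ _ _ (suc t) (begin
        suc t * r N B                           ≡⟨ proj₂ (proj₂ eN B cfB) ⟨
        r Nt (S[ suc t ] B)                     ≡⟨ cong (r Nt) πSA≡SB ⟨
        r Nt (image (proj₁ iso) (S[ suc t ] A)) ≡⟨ r-image Mt Nt iso (S[ suc t ] A) ⟩
        r Mt (S[ suc t ] A)                     ≡⟨ rSA≡ ⟩
        suc t * r M A                           ∎)
      B≡τA : B ≡ image τ A
      B≡τA = Pointwise-≡⇒≡ (ext λ f → begin
        lookup B f                                      ≡⟨ lookup-S-combine (suc t) B f Fin.zero ⟨
        lookup (S[ suc t ] B) (base f)                  ≡⟨ cong (λ W → lookup W (base f)) πSA≡SB ⟨
        lookup (image (proj₁ iso) (S[ suc t ] A)) (base f) ≡⟨ lookup-preimage π.from (S[ suc t ] A) (base f) ⟩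
        lookup (S[ suc t ] A) (π.from (base f))         ≡⟨ compatible f (S[ suc t ] A) cfSA ⟩
        lookup (S[ suc t ] A) (base (τ.from f))         ≡⟨ lookup-S-combine (suc t) A (τ.from f) Fin.zero ⟩
        lookup A (τ.from f)                             ≡⟨ lookup-preimage τ.from A f ⟨
        lookup (image τ A) f                            ∎)

    compatible-sym : ∀ τ → Compatible τ → ∀ e → Inseparable Nt (π.to (base e)) (base (Inverse.to τ e))
    compatible-sym τ compatible e =
      subst (Inseparable Nt (π.to (base e))) (π.strictlyInverseˡ (base (τ.to e)))
        (inseparable-sym Nt (≅-preserves-inseparable Mt Nt iso
          (subst (Inseparable Mt (π.from (base (τ.to e))) ∘ base) (τ.strictlyInverseʳ e) (compatible (τ.to e)))))
      where module τ = Inverse τ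

    ∃compatible : Σ (Fin m ↔ Fin n) Compatible
    ∃compatible = τ , λ f → class≡⇒inseparable Mt
                    (trans (cong sigᴺ (sym (τ.strictlyInverseˡ f))) (proj₂ matching (τ.from f)))
      where
      insepᴹ : ∀ j → Inseparable Mt j (base (quotient {m} (suc t) j))
      insepᴹ j = expansion-inseparable-block (suc t) M Mt eM j Fin.zero
      insepᴺ : ∀ j → Inseparable Mt (π.from j) (π.from (base (quotient {n} (suc t) j)))
      insepᴺ j = ≅-preserves-inseparable Nt Mt (≅-sym Mt Nt iso) (expansion-inseparable-block (suc t) N Nt eN j Fin.zero)
      sigᴹ = signature {n = m} Mt id insepᴹ
      sigᴺ = signature {n = n} Mt π.from insepᴺ
      -- A class of M^t is a union of blocks, which can be counted through the labels of M
      -- or, transported along π, through those of N.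
      multiplicity : ∀ k₀ → ∣ fibre _≟ˢ_ sigᴹ (class Mt k₀) ∣ ≡ ∣ fibre _≟ˢ_ sigᴺ (class Mt k₀) ∣
      multiplicity k₀ = *-cancelˡ-≡ _ _ (suc t) (begin
        suc t * ∣ fibre _≟ˢ_ sigᴹ (class Mt k₀) ∣    ≡⟨ ∣preimage-class∣ {n = m} Mt id insepᴹ k₀ ⟨
        ∣ preimage id (class Mt k₀) ∣          ≡⟨ cong ∣_∣ (tabulate∘lookup (class Mt k₀)) ⟩
        ∣ class Mt k₀ ∣                               ≡⟨ ∣image∣ (proj₁ iso) (class Mt k₀) ⟨
        ∣ image (proj₁ iso) (class Mt k₀) ∣           ≡⟨ ∣preimage-class∣ {n = n} Mt π.from insepᴺ k₀ ⟩
        suc t * ∣ fibre _≟ˢ_ sigᴺ (class Mt k₀) ∣    ∎)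
        where open ≡-Reasoning
      matching = match _≟ˢ_ sigᴹ sigᴺ (multiplicity ∘ base) (multiplicity ∘ π.from ∘ base)
      τ = proj₁ matching
      module τ = Inverse τ

  expansion-≅⁻¹ : ∀ {m n} (M : Matroid m) (N : Matroid n) (Mt : Matroid (m * suc t)) (Nt : Matroid (n * suc t)) →
                  IsExpansion (suc t) M Mt → IsExpansion (suc t) N Nt → Mt ≅ Nt → M ≅ N
  expansion-≅⁻¹ M N Mt Nt eM eN iso =
    let τ , compatible = ∃compatible M N Mt Nt eM eN iso
    in ≅-from-cyclicFlats M N τ (r-image-≤ M N Mt Nt eM eN iso τ compatible)
         (r-image-≤ N M Nt Mt eN eM (≅-sym Mt Nt iso) (↔-sym τ) (compatible-sym M N Mt Nt eM eN iso τ compatible))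

lemma3p3 : (t : ℕ) → {m n : ℕ} → (M : Matroid m) → (N : Matroid n)
           → (Mt : Matroid (m * suc t)) → (Nt : Matroid (n * suc t))
           → IsExpansion (suc t) M Mt → IsExpansion (suc t) N Nt
           → (Mt ≅ Nt) ⇔ (M ≅ N)
lemma3p3 t M N Mt Nt eM eN = mk⇔ (expansion-≅⁻¹ t M N Mt Nt eM eN) (expansion-≅ (suc t) M N Mt Nt eM eN)
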